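{- Let $\pi$ be a permutation of $[n]$. For $i\in[n]$, let $\mathcal{C}_i$ be the set of all $1324$-copies $(x,i,y,j)$ (positions $x<i<y<j$ with $\pi_x<\pi_y<\pi_i<\pi_j$) in $\pi$ whose ``3'' is at position $i$. For $j\in[n]$ let $\mathcal{C}_{i,j}$ be the set of copies in $\mathcal{C}_i$ whose ``4'' is at position $j$, i.e., of the form $\pi_x\pi_i\pi_y\pi_j$. Then $|\mathcal{C}_{i,j}|\le|\mathcal{C}_{i,j'}|$ for all $i<j<j'$ with $\pi_i<\pi_j$ and $\pi_i<\pi_{j'}$.
   Context: A $1324$-copy in a permutation $\pi$ of $[n]$ is a quadruple of positions $a<b<c<d$ with $\pi_a<\pi_c<\pi_b<\pi_d$; its ``1'', ``3'', ``2'', ``4'' are at positions $a,b,c,d$ respectively. -}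

module Defs where

open import Data.Nat using (ℕ)
open import Data.Fin using (Fin; _<_)
open import Data.Fin.Properties using (_<?_)
open import Data.Fin.Permutation using (Permutation′; _⟨$⟩ʳ_)
open import Data.List using (List; length; filter; cartesianProduct; map; concatMap; allFin)
open import Data.Product using (_×_; _,_)
open import Relation.Binary.PropositionalEquality using (_≡_)
open import Relation.Nullary using (Dec)
open import Relation.Nullary.Decidable using (_×-dec_)
open import Data.Fin.Properties using (_≟_)

Quad : ℕ → Set
Quad n = Fin n × Fin n × Fin n × Fin n

Is1324Copy : ∀ {n} → Permutation′ n → Quad n → Set
Is1324Copy π (a , b , c , d) =
  (a < b × b < c × c < d) ×
  ((π ⟨$⟩ʳ a) < (π ⟨$⟩ʳ c) × (π ⟨$⟩ʳ c) < (π ⟨$⟩ʳ b) × (π ⟨$⟩ʳ b) < (π ⟨$⟩ʳ d))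

is1324Copy? : ∀ {n} (π : Permutation′ n) (q : Quad n) → Dec (Is1324Copy π q)
is1324Copy? π (a , b , c , d) =
  ((a <? b) ×-dec ((b <? c) ×-dec (c <? d))) ×-dec
  (((π ⟨$⟩ʳ a) <? (π ⟨$⟩ʳ c)) ×-dec (((π ⟨$⟩ʳ c) <? (π ⟨$⟩ʳ b)) ×-dec ((π ⟨$⟩ʳ b) <? (π ⟨$⟩ʳ d))))

allQuads : (n : ℕ) → List (Quad n)
allQuads n =
  concatMap (λ a → concatMap (λ b → concatMap (λ c → map (λ d → (a , b , c , d))
    (allFin n)) (allFin n)) (allFin n)) (allFin n)

-- Quadruple whose "3" (second entry) is at i and "4" (fourth entry) is at j.
HasThreeFour : ∀ {n} → Fin n → Fin n → Quad n → Set
HasThreeFour i j (a , b , c , d) = b ≡ i × d ≡ j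

hasThreeFour? : ∀ {n} (i j : Fin n) (q : Quad n) → Dec (HasThreeFour i j q)
hasThreeFour? i j (a , b , c , d) = (b ≟ i) ×-dec (d ≟ j)

-- 𝒞_{i,j}: the 1324-copies of π with "3" at position i and "4" at position j,
-- listed without repetition (allQuads has no duplicates).
C : ∀ {n} → Permutation′ n → Fin n → Fin n → List (Quad n)
C π i j = filter (λ q → hasThreeFour? i j q ×-dec is1324Copy? π q) (allQuads _)

cardC : ∀ {n} → Permutation′ n → Fin n → Fin n → ℕ
cardC π i j = length (C π i j)

{-# OPTIONS --safe #-}
-- Moving the "4" of a copy (x , i , y , j) to j′ gives a copy (x , i , y , j′): positions stay
-- increasing because j < j′, and values because π i < π j′. Each fibre of 𝒞_{i,j} over the first
-- three entries has at most one element, so 𝒞_{i,j′} is at least as large fibre by fibre.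
module Submission where

open import Defs
open import Data.Nat using (ℕ; zero; suc; _≤_; _+_; z≤n)
open import Data.Nat.Properties using (+-mono-≤; module ≤-Reasoning)
open import Data.Fin as Fin using (Fin; _<_)
open import Data.Fin.Properties using (_≟_; <-trans)
open import Data.Fin.Permutation using (Permutation′; _⟨$⟩ʳ_)
open import Data.List using (List; []; _∷_; _++_; length; filter; map; concatMap; tabulate; allFin)
open import Data.List.Properties using (filter-++; filter-none; length-++)
open import Data.List.Relation.Unary.All as All using (All)
open import Data.List.Relation.Unary.All.Properties using (tabulate⁺)
open import Data.List.Relation.Binary.Sublist.Propositional using (⊆-refl)
open import Data.List.Relation.Binary.Sublist.Propositional.Properties using (filter⁺; length-mono-≤)
open import Data.Product using (_×_; _,_)
open import Function using (_∘_)
open import Level using (Level)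
open import Relation.Nullary using (yes; no; ¬_)
open import Relation.Nullary.Decidable using (_×-dec_)
open import Relation.Unary using (Pred; Decidable; ∁)
open import Relation.Binary.PropositionalEquality using (_≡_; refl; sym; trans; cong; subst)

private
  variable
    ℓ p q : Level
    A B : Set
    m n : ℕ

count : {P : Pred A ℓ} → Decidable P → List A → ℕ
count P? xs = length (filter P? xs)

module _ {P : Pred A p} {Q : Pred A q} (P? : Decidable P) (Q? : Decidable Q) where

  count-mono : (∀ x → P x → Q x) → ∀ xs → count P? xs ≤ count Q? xs
  count-mono P⇒Q xs = length-mono-≤ (filter⁺ P? Q? (λ { refl → P⇒Q _ }) (⊆-refl {x = xs}))

  count-concatMap-mono : (f : B → List A) → (∀ x → count P? (f x) ≤ count Q? (f x)) →
    ∀ xs → count P? (concatMap f xs) ≤ count Q? (concatMap f xs)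
  count-concatMap-mono f fP≤fQ []       = z≤n
  count-concatMap-mono f fP≤fQ (x ∷ xs) = begin
    count P? (f x ++ concatMap f xs)               ≡⟨ count-++ P? (f x) _ ⟩
    count P? (f x) + count P? (concatMap f xs)     ≤⟨ +-mono-≤ (fP≤fQ x) (count-concatMap-mono f fP≤fQ xs) ⟩
    count Q? (f x) + count Q? (concatMap f xs)     ≡⟨ sym (count-++ Q? (f x) _) ⟩
    count Q? (f x ++ concatMap f xs)               ∎
    where
    open ≤-Reasoning
    count-++ : {R : Pred A ℓ} (R? : Decidable R) (ys zs : List A) →
      count R? (ys ++ zs) ≡ count R? ys + count R? zs
    count-++ R? ys zs = trans (cong length (filter-++ R? ys zs)) (length-++ (filter R? ys))

count-none : {P : Pred A ℓ} (P? : Decidable P) (xs : List A) → All (∁ P) xs → count P? xs ≡ 0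
count-none P? _ ¬Ps = cong length (filter-none P? ¬Ps)

count-map : {P : Pred B ℓ} (P? : Decidable P) (f : A → B) (xs : List A) →
  count P? (map f xs) ≡ count (P? ∘ f) xs
count-map P? f []       = refl
count-map P? f (x ∷ xs) with P? (f x)
... | yes _ = cong suc (count-map P? f xs)
... | no _  = count-map P? f xs

count-≟-tabulate-suc : (g : Fin m → Fin n) (k : Fin n) →
  count (_≟ Fin.suc k) (tabulate (Fin.suc ∘ g)) ≡ count (_≟ k) (tabulate g)
count-≟-tabulate-suc {m = zero}  g k = refl
count-≟-tabulate-suc {m = suc m} g k with g Fin.zero ≟ k
... | yes _ = cong suc (count-≟-tabulate-suc (g ∘ Fin.suc) k)
... | no _  = count-≟-tabulate-suc (g ∘ Fin.suc) k

count-≟-allFin : ∀ n (k : Fin n) → count (_≟ k) (allFin n) ≡ 1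
count-≟-allFin (suc n) Fin.zero    =
  cong suc (count-none (_≟ Fin.zero) (tabulate {n = n} Fin.suc) (tabulate⁺ λ _ ()))
count-≟-allFin (suc n) (Fin.suc k) =
  trans (count-≟-tabulate-suc (λ i → i) k) (count-≟-allFin n k)

count-allFin-≤-singleton : {P : Pred (Fin n) p} {Q : Pred (Fin n) q} (P? : Decidable P) (Q? : Decidable Q)
  {j j′ : Fin n} → (∀ d → P d → d ≡ j) → (P j → Q j′) →
  count P? (allFin n) ≤ count Q? (allFin n)
count-allFin-≤-singleton {n = n} {P = P} P? Q? {j} {j′} P⇒≡j Pj⇒Qj′ with P? j
... | no ¬Pj = begin
  count P? (allFin n)       ≡⟨ count-none P? (allFin n) (All.universal ¬P _) ⟩
  0                         ≤⟨ z≤n ⟩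
  count Q? (allFin n)       ∎
  where
  open ≤-Reasoning
  ¬P : ∀ d → ¬ P d
  ¬P d Pd = ¬Pj (subst P (P⇒≡j d Pd) Pd)
... | yes Pj = begin
  count P? (allFin n)       ≤⟨ count-mono P? (_≟ j) P⇒≡j (allFin n) ⟩
  count (_≟ j) (allFin n)   ≡⟨ count-≟-allFin n j ⟩
  1                         ≡⟨ sym (count-≟-allFin n j′) ⟩
  count (_≟ j′) (allFin n)  ≤⟨ count-mono (_≟ j′) Q? (λ { _ refl → Pj⇒Qj′ Pj }) (allFin n) ⟩
  count Q? (allFin n)       ∎
  where open ≤-Reasoning

count-allQuads-mono : {P : Pred (Quad n) p} {Q : Pred (Quad n) q} (P? : Decidable P) (Q? : Decidable Q) →
  (∀ a b c → count (λ d → P? (a , b , c , d)) (allFin n)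
          ≤ count (λ d → Q? (a , b , c , d)) (allFin n)) →
  count P? (allQuads n) ≤ count Q? (allQuads n)
count-allQuads-mono {n = n} P? Q? fibreP≤fibreQ =
  count-concatMap-mono P? Q? _ (λ a →
    count-concatMap-mono P? Q? _ (λ b →
      count-concatMap-mono P? Q? _ (λ c → fibre a b c) (allFin n)) (allFin n)) (allFin n)
  where
  open ≤-Reasoning
  fibre : ∀ a b c → count P? (map (λ d → (a , b , c , d)) (allFin n))
                  ≤ count Q? (map (λ d → (a , b , c , d)) (allFin n))
  fibre a b c = begin
    count P? (map (λ d → (a , b , c , d)) (allFin n))  ≡⟨ count-map P? _ (allFin n) ⟩
    count (λ d → P? (a , b , c , d)) (allFin n)        ≤⟨ fibreP≤fibreQ a b c ⟩
    count (λ d → Q? (a , b , c , d)) (allFin n)        ≡⟨ sym (count-map Q? _ (allFin n)) ⟩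
    count Q? (map (λ d → (a , b , c , d)) (allFin n))  ∎

is1324Copy-moveFour : (π : Permutation′ n) {a b c d d′ : Fin n} → Is1324Copy π (a , b , c , d) →
  d < d′ → (π ⟨$⟩ʳ b) < (π ⟨$⟩ʳ d′) → Is1324Copy π (a , b , c , d′)
is1324Copy-moveFour π ((a<b , b<c , c<d) , (πa<πc , πc<πb , _)) d<d′ πb<πd′ =
  (a<b , b<c , <-trans c<d d<d′) , (πa<πc , πc<πb , πb<πd′)

lemma3p2 : (n : ℕ) (π : Permutation′ n) (i j j′ : Fin n) →
    i < j → j < j′ → (π ⟨$⟩ʳ i) < (π ⟨$⟩ʳ j) → (π ⟨$⟩ʳ i) < (π ⟨$⟩ʳ j′) →
    cardC π i j ≤ cardC π i j′
lemma3p2 n π i j j′ _ j<j′ _ πi<πj′ =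
  count-allQuads-mono (copyAt j) (copyAt j′) λ a b c →
    count-allFin-≤-singleton (λ d → copyAt j (a , b , c , d)) (λ d → copyAt j′ (a , b , c , d))
      (λ _ ((_ , d≡j) , _) → d≡j) λ where
        ((refl , _) , copy) → (refl , refl) , is1324Copy-moveFour π copy j<j′ πi<πj′
  where
  copyAt : ∀ k → Decidable (λ q → HasThreeFour i k q × Is1324Copy π q)
  copyAt k q = hasThreeFour? i k q ×-dec is1324Copy? π q
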